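{- Let $\mathcal{D}=(\mathrm{Col},\mathrm{T},\text{white})$ be a domino tiling system in which no tile has more than two white sides. If $\mathcal{D}$ is solvable, then there exists a $\mathcal{D}$-snake.
   Context: A domino tiling system is a triple $\mathcal{D}=(\mathrm{Col},\mathrm{T},\text{white})$, where $\mathrm{Col}$ is a finite set of colours, $\mathrm{T}\subseteq\mathrm{Col}^4$, and $\text{white}\in\mathrm{Col}$. A tile $(c_l,c_d,c_r,c_u)$ is: - left-border if $c_l=\text{white}$; - down-border if $c_d=\text{white}$; - right-border if $c_r=\text{white}$; - up-border if $c_u=\text{white}$. Tiles $t=(c_l,c_d,c_r,c_u)$ and $t'=(c_l',c_d',c_r',c_u')$ are H-compatible if $c_r=c_l'$, and V-compatible if $c_u=c_d'$. Let $\mathbb{Z}_n=\{0,\dots,n-1\}$. $\mathcal{D}$ covers $\mathbb{Z}_n\times\mathbb{Z}_m$ if there is $\xi:\mathbb{Z}_n\times\mathbb{Z}_m\to\mathrm{T}$ such that for all $(x,y)$ with $\xi(x,y)=(c_l,c_d,c_r,c_u)$: - $x=0$ iff $c_l=\text{white}$; $x=n-1$ iff $c_r=\text{white}$; $y=0$ iff $c_d=\text{white}$; $y=m-1$ iff $c_u=\text{white}$; - $\xi(x,y),\xi(x+1,y)$ are H-compatible whenever $x+1<n$; - $\xi(x,y),\xi(x,y+1)$ are V-compatible whenever $y+1<m$. $\mathcal{D}$ is solvable if it covers $\mathbb{Z}_n\times\mathbb{Z}_m$ for some positive integers $n,m$. Fix a role name $r$, concept names $C_t$ for $t\in\mathrm{T}$,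 and individual names $ld,rd,lu,ru$. In an interpretation $\mathcal{I}$: - an element $d$ carries $t$ if $d\in C_t^{\mathcal{I}}$; - an $r$-path is a sequence $\rho_1\cdots\rho_k$ of elements with $(\rho_j,\rho_{j+1})\in r^{\mathcal{I}}$ for all $j$; its length is $k-1$; - $e$ is $r^\ell$-reachable (resp. $r^+$-, $r^*$-reachable) from $d$ if some $r$-path of length $\ell$ (resp. positive, arbitrary length) goes from $d$ to $e$. $\mathcal{I}$ is a $\mathcal{D}$-snake if all of the following hold: (SPath) There is an $r$-path $\rho_1\cdots\rho_k$ and indices $1<i<j<k$ with $\rho_1=ld^{\mathcal{I}}$, $\rho_i=rd^{\mathcal{I}}$, $\rho_j=lu^{\mathcal{I}}$ and $\rho_k=ru^{\mathcal{I}}$. (SNoLoop) None of $ld^{\mathcal{I}},rd^{\mathcal{I}},lu^{\mathcal{I}},ru^{\mathcal{I}}$ is $r^+$-reachable from itself. (SUniqTil) Every element $r^*$-reachable from $ld^{\mathcal{I}}$ carries exactly one tile of $\mathrm{T}$. (SSpecTil) An element $r^*$-reachable from $ld^{\mathcal{I}}$ carries a tile with two white sides iff it is one of $ld^{\mathcal{I}},rd^{\mathcal{I}},lu^{\mathcal{I}},ru^{\mathcal{I}}$. Moreover: - $ld^{\mathcal{I}}$ carries a left- and down-border tile; - $rd^{\mathcal{I}}$ carries a right- and down-border tile; - $lu^{\mathcal{I}}$ carries a left- and up-border tile; - $ru^{\mathcal{I}}$ carries a right- and up-border tile. (SHori) Let $d\neq ru^{\mathcal{I}}$ be $r^*$-reachable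 from $ld^{\mathcal{I}}$ and carry $t=(c_l,c_d,c_r,c_u)$. Then there is $t'=(c_l',c_d',c_r',c_u')$ such that all $r$-successors of $d$ carry $t'$, and: - (i) $t,t'$ are H-compatible; - (ii) if $c_d=\text{white}$ then ($c_r\neq\text{white}$ iff $c_d'=\text{white}$); - (iii) if $c_u=\text{white}$ then $c_u'=\text{white}$. (SLen) There is a unique positive integer $N$ such that all $r$-paths of positive length from $ld^{\mathcal{I}}$ to $rd^{\mathcal{I}}$ have length $N-1$. Moreover, $rd^{\mathcal{I}}$ is the only element $r^{N-1}$-reachable from $ld^{\mathcal{I}}$. (SVerti) Let $d$ be $r^*$-reachable from $ld^{\mathcal{I}}$ and carry a tile $t$ that is not up-border, and let $N$ be as in (SLen). Then there is $t'\in\mathrm{T}$ such that: - all elements $r^N$-reachable from $d$ carry $t'$; - $t,t'$ are V-compatible; - $t$ is left-border (resp. right-border) iff $t'$ is. -}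

module Defs where

open import Data.Nat using (ℕ; zero; suc; _+_; _∸_; _≤_; _<_)
open import Data.Fin using (Fin; toℕ; fromℕ<) renaming (_≟_ to _≟ᶠ_)
open import Data.List using (List)
open import Data.List.Membership.Propositional using (_∈_)
open import Data.Product using (Σ; ∃; ∃-syntax; _×_; _,_)
open import Data.Sum using (_⊎_)
open import Relation.Nullary using (¬_; Dec; yes; no)
open import Relation.Binary.PropositionalEquality using (_≡_; _≢_)
open import Function.Bundles using (_⇔_)

record Tile (k : ℕ) : Set where
  constructor tile
  field
    cl cd cr cu : Fin k
open Tile public

record DTS : Set where
  field
    k     : ℕ
    T     : List (Tile k)
    white : Fin k
open DTS public

module _ (D : DTS) where
  Col = Fin (k D)
  Tl  = Tile (k D)

  LeftB DownB RightB UpB : Tl → Set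
  LeftB  t = cl t ≡ white D
  DownB  t = cd t ≡ white D
  RightB t = cr t ≡ white D
  UpB    t = cu t ≡ white D

  private
    w : Col → ℕ
    w c with c ≟ᶠ white D
    ... | yes _ = 1
    ... | no  _ = 0

  whiteSides : Tl → ℕ
  whiteSides t = w (cl t) + w (cd t) + w (cr t) + w (cu t)

  TwoWhite : Tl → Set
  TwoWhite t = whiteSides t ≡ 2

  HCompat VCompat : Tl → Tl → Set
  HCompat t t' = cr t ≡ cl t'
  VCompat t t' = cu t ≡ cd t'

  AtMostTwoWhite : Set
  AtMostTwoWhite = ∀ t → t ∈ T D → whiteSides t ≤ 2

  Covers : ℕ → ℕ → Set
  Covers n m =
    Σ (Fin n → Fin m → Tl) λ ξ →
      (∀ x y → ξ x y ∈ T D)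
    × (∀ x y → (toℕ x ≡ 0) ⇔ LeftB (ξ x y))
    × (∀ x y → (toℕ x ≡ n ∸ 1) ⇔ RightB (ξ x y))
    × (∀ x y → (toℕ y ≡ 0) ⇔ DownB (ξ x y))
    × (∀ x y → (toℕ y ≡ m ∸ 1) ⇔ UpB (ξ x y))
    × (∀ x y → (p : suc (toℕ x) < n) → HCompat (ξ x y) (ξ (fromℕ< p) y))
    × (∀ x y → (p : suc (toℕ y) < m) → VCompat (ξ x y) (ξ x (fromℕ< p)))

  Solvable : Set
  Solvable = Σ ℕ λ n → Σ ℕ λ m → (0 < n) × (0 < m) × Covers n m

  -- Interpretations over the signature: role r, concept names C_t
  -- (t ∈ T), individual names ld, rd, lu, ru.
  record Interp : Set₁ where
    field
      Δ  : Set
      r  : Δ → Δ → Set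
      C  : Tl → Δ → Set     -- C t d : "d ∈ C_t^I" (only used for t ∈ T)
      ld rd lu ru : Δ

  module _ (I : Interp) where
    open Interp I

    data RPath : Δ → Δ → ℕ → Set where
      here  : ∀ {d} → RPath d d 0
      there : ∀ {d e f ℓ} → r d e → RPath e f ℓ → RPath d f (suc ℓ)

    Reach* Reach+ : Δ → Δ → Set
    Reach* d e = ∃[ ℓ ] RPath d e ℓ
    Reach+ d e = ∃[ ℓ ] RPath d e (suc ℓ)


    Carries : Δ → Tl → Set
    Carries d t = (t ∈ T D) × C t d

    Special : Δ → Set
    Special d = (d ≡ ld) ⊎ (d ≡ rd) ⊎ (d ≡ lu) ⊎ (d ≡ ru)

    AllLen : ℕ → Set
    AllLen N = ∀ ℓ → RPath ld rd (suc ℓ) → suc ℓ ≡ N ∸ 1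

    record Snake : Set where
      field
        -- (SPath): one r-path ld ⋯ rd ⋯ lu ⋯ ru with 1 < i < j < k,
        -- i.e. the concatenation of three paths of positive length
        sPath : Σ ℕ λ a → Σ ℕ λ b → Σ ℕ λ c →
                RPath ld rd (suc a) × RPath rd lu (suc b) × RPath lu ru (suc c)
        sNoLoop : ¬ Reach+ ld ld × ¬ Reach+ rd rd × ¬ Reach+ lu lu × ¬ Reach+ ru ru
        sUniqTil : ∀ d → Reach* ld d →
                   Σ Tl λ t → Carries d t × (∀ t' → Carries d t' → t' ≡ t)
        sSpecTil : ∀ d → Reach* ld d →
                   (Σ Tl λ t → Carries d t × TwoWhite t) ⇔ Special d
        sSpecLD : Σ Tl λ t → Carries ld t × LeftB t × DownB t
        sSpecRD : Σ Tl λ t → Carries rd t × RightB t × DownB t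
        sSpecLU : Σ Tl λ t → Carries lu t × LeftB t × UpB t
        sSpecRU : Σ Tl λ t → Carries ru t × RightB t × UpB t
        sHori : ∀ d → Reach* ld d → d ≢ ru → ∀ t → Carries d t →
                Σ Tl λ t' → (t' ∈ T D)
                  × (∀ e → r d e → C t' e)
                  × HCompat t t'
                  × (DownB t → (¬ RightB t) ⇔ DownB t')
                  × (UpB t → UpB t')
        N : ℕ
        N-pos : 0 < N
        sLenAll : AllLen N
        sLenUniq : ∀ N' → 0 < N' → AllLen N' → N' ≡ N
        sLenOnly : ∀ e → RPath ld e (N ∸ 1) → e ≡ rd
        sVerti : ∀ d → Reach* ld d → ∀ t → Carries d t → ¬ UpB t →
                 Σ Tl λ t' → (t' ∈ T D)
                   × (∀ e → RPath d e N → C t' e)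
                   × VCompat t t'
                   × (LeftB t ⇔ LeftB t')
                   × (RightB t ⇔ RightB t')

  HasSnake : Set₁
  HasSnake = Σ Interp Snake

-- A covering ξ of an n × m grid is read row by row, left to right, as one r-chain
-- ld = (0,0) → (1,0) → … → (n-1,0) → (0,1) → … → (n-1,m-1) = ru, each cell carrying
-- its tile.  Horizontal neighbours (and the wrap-around from the end of a row to the
-- start of the next one) are then r-successors, vertical neighbours are exactly n steps
-- apart, and the corner cells are the only ones with two white sides.  The bound on
-- white sides rules out the degenerate grids with n = 1 or m = 1, whose corner tile
-- would have three white sides; for n, m ≥ 2 this chain is a D-snake with N = n.
module Submission where

open import Defs
open import Data.Nat using (ℕ; zero; suc; _+_; _*_; _≤_; _<_; z≤n; s≤s; z<s; s≤s⁻¹)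
open import Data.Nat.Properties
  using (+-comm; +-assoc; +-suc; +-identityʳ; *-suc; +-cancelʳ-≡; +-commutativeSemigroup;
         m≤n+m; ≤-<-trans; ≤∧≢⇒<; <⇒≱; 1+n≢0; m≤n⇒∃[o]m+o≡n)
open import Data.Fin using (Fin; toℕ; fromℕ; fromℕ<; combine; remQuot) renaming (_≟_ to _≟ᶠ_)
open import Data.Fin.Patterns using (0F)
open import Data.Fin.Properties
  using (toℕ-injective; toℕ<n; toℕ-fromℕ; toℕ-fromℕ<; toℕ-combine; remQuot-combine;
         combine-injective; combine-surjective; combine-monoˡ-<)
open import Data.List.Membership.Propositional using (_∈_)
open import Data.Product using (Σ; ∃; ∃₂; _×_; _,_; proj₁; proj₂; map; swap)
open import Data.Product.Function.NonDependent.Propositional using (_×-⇔_)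
open import Data.Sum using (_⊎_; inj₁; inj₂)
import Data.Sum as Sum
open import Data.Sum.Function.Propositional using (_⊎-⇔_)
open import Data.Empty using (⊥; ⊥-elim)
open import Function.Base using (_∘_)
open import Function.Bundles using (_⇔_; mk⇔; Equivalence)
open import Function.Construct.Composition using (_⇔-∘_)
open import Function.Construct.Symmetry using (⇔-sym)
open import Relation.Nullary using (¬_; yes; no)
open import Relation.Binary.PropositionalEquality
  using (_≡_; _≢_; refl; sym; trans; cong; subst; module ≡-Reasoning)
open import Algebra.Properties.CommutativeSemigroup +-commutativeSemigroup using (interchange)

open Equivalence using (to; from)
open ≡-Reasoning

Extreme : ∀ {k} → Fin (suc k) → Set
Extreme {k} x = x ≡ 0F ⊎ x ≡ fromℕ k

toℕ≡0⇔≡0F : ∀ {k} {x : Fin (suc k)} → (toℕ x ≡ 0) ⇔ (x ≡ 0F)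
toℕ≡0⇔≡0F = mk⇔ toℕ-injective (cong toℕ)

toℕ≡k⇔≡fromℕ : ∀ {k} {x : Fin (suc k)} → (toℕ x ≡ k) ⇔ (x ≡ fromℕ k)
toℕ≡k⇔≡fromℕ {k} = mk⇔ (λ e → toℕ-injective (trans e (sym (toℕ-fromℕ k))))
                       (λ e → trans (cong toℕ e) (toℕ-fromℕ k))

suc-toℕ< : ∀ {k} (x : Fin (suc k)) → x ≢ fromℕ k → suc (toℕ x) < suc k
suc-toℕ< {k} x x≢k = s≤s (≤∧≢⇒< (s≤s⁻¹ (toℕ<n x)) (x≢k ∘ to toℕ≡k⇔≡fromℕ))

+≡2⇔both≡1 : ∀ {u v} → u ≤ 1 → v ≤ 1 → (u + v ≡ 2) ⇔ (u ≡ 1 × v ≡ 1)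
+≡2⇔both≡1 z≤n       z≤n       = mk⇔ (λ ()) (λ { (() , _) })
+≡2⇔both≡1 z≤n       (s≤s z≤n) = mk⇔ (λ ()) (λ { (() , _) })
+≡2⇔both≡1 (s≤s z≤n) z≤n       = mk⇔ (λ ()) (λ { (_ , ()) })
+≡2⇔both≡1 (s≤s z≤n) (s≤s z≤n) = mk⇔ (λ _ → refl , refl) (λ _ → refl)

module _ (D : DTS) where

  isWhite : Col D → ℕ
  isWhite c with c ≟ᶠ white D
  ... | yes _ = 1
  ... | no  _ = 0

  -- Defs counts white sides with a private function, so its value can only be
  -- exposed by deciding all four sides at once.
  whiteSides≡ : ∀ t → whiteSides D t ≡ isWhite (cl t) + isWhite (cd t) + isWhite (cr t) + isWhite (cu t)
  whiteSides≡ (tile l d r u) with l ≟ᶠ white D | d ≟ᶠ white D | r ≟ᶠ white D | u ≟ᶠ white D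
  ... | yes _ | yes _ | yes _ | yes _ = refl
  ... | yes _ | yes _ | yes _ | no  _ = refl
  ... | yes _ | yes _ | no  _ | yes _ = refl
  ... | yes _ | yes _ | no  _ | no  _ = refl
  ... | yes _ | no  _ | yes _ | yes _ = refl
  ... | yes _ | no  _ | yes _ | no  _ = refl
  ... | yes _ | no  _ | no  _ | yes _ = refl
  ... | yes _ | no  _ | no  _ | no  _ = refl
  ... | no  _ | yes _ | yes _ | yes _ = refl
  ... | no  _ | yes _ | yes _ | no  _ = refl
  ... | no  _ | yes _ | no  _ | yes _ = refl
  ... | no  _ | yes _ | no  _ | no  _ = refl
  ... | no  _ | no  _ | yes _ | yes _ = refl
  ... | no  _ | no  _ | yes _ | no  _ = refl
  ... | no  _ | no  _ | no  _ | yes _ = refl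
  ... | no  _ | no  _ | no  _ | no  _ = refl

  isWhite-white : ∀ {c} → c ≡ white D → isWhite c ≡ 1
  isWhite-white {c} c≡w with c ≟ᶠ white D
  ... | yes _   = refl
  ... | no  c≢w = ⊥-elim (c≢w c≡w)

  isWhite-pair≤1 : ∀ {c c'} → ¬ (c ≡ white D × c' ≡ white D) → isWhite c + isWhite c' ≤ 1
  isWhite-pair≤1 {c} {c'} notBoth with c ≟ᶠ white D | c' ≟ᶠ white D
  ... | yes p | yes q = ⊥-elim (notBoth (p , q))
  ... | yes _ | no  _ = s≤s z≤n
  ... | no  _ | yes _ = s≤s z≤n
  ... | no  _ | no  _ = z≤n

  isWhite-pair≡1⇔ : ∀ {c c'} → ¬ (c ≡ white D × c' ≡ white D) →
                    (isWhite c + isWhite c' ≡ 1) ⇔ (c ≡ white D ⊎ c' ≡ white D)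
  isWhite-pair≡1⇔ {c} {c'} notBoth with c ≟ᶠ white D | c' ≟ᶠ white D
  ... | yes p | yes q = ⊥-elim (notBoth (p , q))
  ... | yes p | no  _ = mk⇔ (λ _ → inj₁ p) (λ _ → refl)
  ... | no  _ | yes q = mk⇔ (λ _ → inj₂ q) (λ _ → refl)
  ... | no  p | no  q = mk⇔ (λ ()) (⊥-elim ∘ Sum.[ p , q ])

  TwoWhite⇔ : ∀ t → ¬ (LeftB D t × RightB D t) → ¬ (DownB D t × UpB D t) →
              TwoWhite D t ⇔ ((LeftB D t ⊎ RightB D t) × (DownB D t ⊎ UpB D t))
  TwoWhite⇔ t notLR notDU =
    (isWhite-pair≡1⇔ notLR ×-⇔ isWhite-pair≡1⇔ notDU)
      ⇔-∘ (+≡2⇔both≡1 (isWhite-pair≤1 notLR) (isWhite-pair≤1 notDU)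
      ⇔-∘ mk⇔ (trans (sym regroup)) (trans regroup))
    where
    regroup : whiteSides D t ≡ (isWhite (cl t) + isWhite (cr t)) + (isWhite (cd t) + isWhite (cu t))
    regroup = begin
      whiteSides D t
        ≡⟨ whiteSides≡ t ⟩
      isWhite (cl t) + isWhite (cd t) + isWhite (cr t) + isWhite (cu t)
        ≡⟨ +-assoc (isWhite (cl t) + isWhite (cd t)) (isWhite (cr t)) (isWhite (cu t)) ⟩
      (isWhite (cl t) + isWhite (cd t)) + (isWhite (cr t) + isWhite (cu t))
        ≡⟨ interchange (isWhite (cl t)) (isWhite (cd t)) (isWhite (cr t)) (isWhite (cu t)) ⟩
      (isWhite (cl t) + isWhite (cr t)) + (isWhite (cd t) + isWhite (cu t)) ∎

  2<whiteSides : ∀ {t} → LeftB D t → DownB D t → RightB D t ⊎ UpB D t → 2 < whiteSides D t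
  2<whiteSides {t} left down third
    rewrite whiteSides≡ t | isWhite-white left | isWhite-white down with third
  ... | inj₁ right rewrite isWhite-white right = s≤s (s≤s (s≤s z≤n))
  ... | inj₂ up    rewrite isWhite-white up    = s≤s (s≤s (m≤n+m 1 (isWhite (cr t))))

  thinCover-impossible : ∀ {n m} → AtMostTwoWhite D → Covers D (suc n) (suc m) → n ≡ 0 ⊎ m ≡ 0 → ⊥
  thinCover-impossible atMostTwo (ξ , ξ∈T , left , right , down , up , _) thin =
    <⇒≱ (2<whiteSides (to (left 0F 0F) refl) (to (down 0F 0F) refl)
                      (Sum.map (to (right 0F 0F) ∘ sym) (to (up 0F 0F) ∘ sym) thin))
        (atMostTwo (ξ 0F 0F) (ξ∈T 0F 0F))

module Chain (D : DTS) {L : ℕ} (C : Tl D → Fin L → Set) (ld rd lu ru : Fin L) where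

  chain : Interp D
  chain = record { Δ = Fin L ; r = λ d e → toℕ e ≡ suc (toℕ d) ; C = C
                 ; ld = ld ; rd = rd ; lu = lu ; ru = ru }

  RPath-toℕ : ∀ {d e ℓ} → RPath D chain d e ℓ → toℕ e ≡ ℓ + toℕ d
  RPath-toℕ here = refl
  RPath-toℕ {d} (there {ℓ = ℓ} d→d' p) = trans (RPath-toℕ p) (trans (cong (ℓ +_) d→d') (+-suc ℓ (toℕ d)))

  rpath : ∀ ℓ {d e} → toℕ e ≡ ℓ + toℕ d → RPath D chain d e ℓ
  rpath zero eq with refl ← toℕ-injective eq = here
  rpath (suc ℓ) {d} {e} eq =
    there (toℕ-fromℕ< d+1<L)
          (rpath ℓ (trans eq (trans (sym (+-suc ℓ (toℕ d))) (cong (ℓ +_) (sym (toℕ-fromℕ< d+1<L))))))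
    where
    d+1<L : suc (toℕ d) < L
    d+1<L = ≤-<-trans (s≤s (m≤n+m (toℕ d) ℓ)) (subst (_< L) eq (toℕ<n e))

  rpath-< : ∀ {d e} → toℕ d < toℕ e → ∃ λ ℓ → RPath D chain d e (suc ℓ)
  rpath-< {d} d<e with ℓ , eq ← m≤n⇒∃[o]m+o≡n d<e =
    ℓ , rpath (suc ℓ) (trans (sym eq) (cong suc (+-comm (toℕ d) ℓ)))

  RPath-length : ∀ {d e ℓ ℓ'} → RPath D chain d e ℓ → RPath D chain d e ℓ' → ℓ ≡ ℓ'
  RPath-length {d} {ℓ = ℓ} {ℓ'} p q = +-cancelʳ-≡ (toℕ d) ℓ ℓ' (trans (sym (RPath-toℕ p)) (RPath-toℕ q))

  RPath-functional : ∀ {d e e' ℓ} → RPath D chain d e ℓ → RPath D chain d e' ℓ → e ≡ e'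
  RPath-functional p q = toℕ-injective (trans (RPath-toℕ p) (sym (RPath-toℕ q)))

  no-loop : ∀ d → ¬ Reach+ D chain d d
  no-loop d (_ , p) = 1+n≢0 (RPath-length p here)

module Grid (D : DTS) {a b : ℕ} (cov : Covers D (suc (suc a)) (suc (suc b))) where

  n m : ℕ
  n = suc (suc a)
  m = suc (suc b)

  lastX : Fin n
  lastX = fromℕ (suc a)

  lastY : Fin m
  lastY = fromℕ (suc b)

  ξ : Fin n → Fin m → Tl D
  ξ = proj₁ cov

  ξ∈T : ∀ x y → ξ x y ∈ T D
  ξ∈T = proj₁ (proj₂ cov)

  leftB⇔ : ∀ x y → (x ≡ 0F) ⇔ LeftB D (ξ x y)
  leftB⇔ x y = proj₁ (proj₂ (proj₂ cov)) x y ⇔-∘ ⇔-sym toℕ≡0⇔≡0F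

  rightB⇔ : ∀ x y → (x ≡ lastX) ⇔ RightB D (ξ x y)
  rightB⇔ x y = proj₁ (proj₂ (proj₂ (proj₂ cov))) x y ⇔-∘ ⇔-sym toℕ≡k⇔≡fromℕ

  downB⇔ : ∀ x y → (y ≡ 0F) ⇔ DownB D (ξ x y)
  downB⇔ x y = proj₁ (proj₂ (proj₂ (proj₂ (proj₂ cov)))) x y ⇔-∘ ⇔-sym toℕ≡0⇔≡0F

  upB⇔ : ∀ x y → (y ≡ lastY) ⇔ UpB D (ξ x y)
  upB⇔ x y = proj₁ (proj₂ (proj₂ (proj₂ (proj₂ (proj₂ cov))))) x y ⇔-∘ ⇔-sym toℕ≡k⇔≡fromℕ

  hcompat : ∀ x y (p : suc (toℕ x) < n) → HCompat D (ξ x y) (ξ (fromℕ< p) y)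
  hcompat = proj₁ (proj₂ (proj₂ (proj₂ (proj₂ (proj₂ (proj₂ cov))))))

  vcompat : ∀ x y (p : suc (toℕ y) < m) → VCompat D (ξ x y) (ξ x (fromℕ< p))
  vcompat = proj₂ (proj₂ (proj₂ (proj₂ (proj₂ (proj₂ (proj₂ cov))))))

  cell : Fin n → Fin m → Fin (m * n)
  cell x y = combine y x

  toℕ-cell : ∀ x y → toℕ (cell x y) ≡ n * toℕ y + toℕ x
  toℕ-cell x y = toℕ-combine y x

  cell-injective : ∀ {x y x' y'} → cell x y ≡ cell x' y' → x ≡ x' × y ≡ y'
  cell-injective {x} {y} {x'} {y'} = swap ∘ combine-injective y x y' x'

  cell-surjective : ∀ d → ∃₂ λ x y → cell x y ≡ d
  cell-surjective d with y , x , eq ← combine-surjective {m} {n} d = x , y , eq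

  toℕ-cell-row : ∀ x y → toℕ (cell x y) ≡ toℕ x + toℕ (cell 0F y)
  toℕ-cell-row x y = begin
    toℕ (cell x y)           ≡⟨ toℕ-cell x y ⟩
    n * toℕ y + toℕ x        ≡⟨ +-comm (n * toℕ y) (toℕ x) ⟩
    toℕ x + n * toℕ y        ≡⟨ cong (toℕ x +_) (+-identityʳ (n * toℕ y)) ⟨
    toℕ x + (n * toℕ y + 0)  ≡⟨ cong (toℕ x +_) (toℕ-cell 0F y) ⟨
    toℕ x + toℕ (cell 0F y)  ∎

  toℕ-cell-right : ∀ x x' y → toℕ x' ≡ suc (toℕ x) → toℕ (cell x' y) ≡ 1 + toℕ (cell x y)
  toℕ-cell-right x x' y eq = begin
    toℕ (cell x' y)           ≡⟨ toℕ-cell x' y ⟩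
    n * toℕ y + toℕ x'        ≡⟨ cong (n * toℕ y +_) eq ⟩
    n * toℕ y + suc (toℕ x)   ≡⟨ +-suc (n * toℕ y) (toℕ x) ⟩
    suc (n * toℕ y + toℕ x)   ≡⟨ cong suc (toℕ-cell x y) ⟨
    1 + toℕ (cell x y)        ∎

  toℕ-cell-wrap : ∀ y y' → toℕ y' ≡ suc (toℕ y) → toℕ (cell 0F y') ≡ 1 + toℕ (cell lastX y)
  toℕ-cell-wrap y y' eq = begin
    toℕ (cell 0F y')              ≡⟨ toℕ-cell 0F y' ⟩
    n * toℕ y' + 0                ≡⟨ +-identityʳ (n * toℕ y') ⟩
    n * toℕ y'                    ≡⟨ cong (n *_) eq ⟩
    n * suc (toℕ y)               ≡⟨ *-suc n (toℕ y) ⟩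
    n + n * toℕ y                 ≡⟨ cong suc (+-comm (suc a) (n * toℕ y)) ⟩
    1 + (n * toℕ y + suc a)       ≡⟨ cong (λ i → 1 + (n * toℕ y + i)) (toℕ-fromℕ (suc a)) ⟨
    1 + (n * toℕ y + toℕ lastX)   ≡⟨ cong suc (toℕ-cell lastX y) ⟨
    1 + toℕ (cell lastX y)        ∎

  toℕ-cell-up : ∀ x y y' → toℕ y' ≡ suc (toℕ y) → toℕ (cell x y') ≡ n + toℕ (cell x y)
  toℕ-cell-up x y y' eq = begin
    toℕ (cell x y')                ≡⟨ toℕ-cell x y' ⟩
    n * toℕ y' + toℕ x             ≡⟨ cong (λ i → n * i + toℕ x) eq ⟩
    n * suc (toℕ y) + toℕ x        ≡⟨ cong (_+ toℕ x) (*-suc n (toℕ y)) ⟩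
    n + n * toℕ y + toℕ x          ≡⟨ +-assoc n (n * toℕ y) (toℕ x) ⟩
    n + (n * toℕ y + toℕ x)        ≡⟨ cong (n +_) (toℕ-cell x y) ⟨
    n + toℕ (cell x y)             ∎

  tileAt : Fin (m * n) → Tl D
  tileAt d = ξ (proj₂ (remQuot {m} n d)) (proj₁ (remQuot {m} n d))

  tileAt-cell : ∀ x y → tileAt (cell x y) ≡ ξ x y
  tileAt-cell x y = cong (λ (y , x) → ξ x y) (remQuot-combine {m} {n} y x)

  tileAt∈T : ∀ d → tileAt d ∈ T D
  tileAt∈T d with x , y , refl ← cell-surjective d = subst (_∈ T D) (sym (tileAt-cell x y)) (ξ∈T x y)

  open Chain D (λ t d → t ≡ tileAt d) (cell 0F 0F) (cell lastX 0F) (cell 0F lastY) (cell lastX lastY)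
    public

  carries-cell : ∀ x y → Carries D chain (cell x y) (ξ x y)
  carries-cell x y = ξ∈T x y , sym (tileAt-cell x y)

  cell-carrier-elim : ∀ {P : Fin (m * n) → Tl D → Set} → (∀ x y → P (cell x y) (ξ x y)) →
                ∀ d t → Carries D chain d t → P d t
  cell-carrier-elim {P} h d t (_ , refl) with x , y , refl ← cell-surjective d =
    subst (P (cell x y)) (sym (tileAt-cell x y)) (h x y)

  tile-after : ∀ {d} x' y' ℓ → toℕ (cell x' y') ≡ ℓ + toℕ d →
               ∀ e → RPath D chain d e ℓ → ξ x' y' ≡ tileAt e
  tile-after x' y' ℓ eq e p =
    trans (sym (tileAt-cell x' y')) (cong tileAt (RPath-functional (rpath ℓ eq) p))

  row-path : ∀ x y → RPath D chain (cell 0F y) (cell x y) (toℕ x)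
  row-path x y = rpath (toℕ x) (toℕ-cell-row x y)

  ld→rd : RPath D chain (cell 0F 0F) (cell lastX 0F) (suc a)
  ld→rd = subst (RPath D chain _ _) (toℕ-fromℕ (suc a)) (row-path lastX 0F)

  rd<lu : toℕ (cell lastX 0F) < toℕ (cell 0F lastY)
  rd<lu = combine-monoˡ-< {i = 0F} {j = lastY} lastX 0F z<s

  special→extreme : ∀ {x y} → Special D chain (cell x y) → Extreme x × Extreme y
  special→extreme (inj₁ e)               = map inj₁ inj₁ (cell-injective e)
  special→extreme (inj₂ (inj₁ e))        = map inj₂ inj₁ (cell-injective e)
  special→extreme (inj₂ (inj₂ (inj₁ e))) = map inj₁ inj₂ (cell-injective e)
  special→extreme (inj₂ (inj₂ (inj₂ e))) = map inj₂ inj₂ (cell-injective e)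

  extreme→special : ∀ {x y} → Extreme x × Extreme y → Special D chain (cell x y)
  extreme→special (inj₁ refl , inj₁ refl) = inj₁ refl
  extreme→special (inj₂ refl , inj₁ refl) = inj₂ (inj₁ refl)
  extreme→special (inj₁ refl , inj₂ refl) = inj₂ (inj₂ (inj₁ refl))
  extreme→special (inj₂ refl , inj₂ refl) = inj₂ (inj₂ (inj₂ refl))

  twoWhite⇔extreme : ∀ x y → TwoWhite D (ξ x y) ⇔ (Extreme x × Extreme y)
  twoWhite⇔extreme x y =
    ((⇔-sym (leftB⇔ x y) ⊎-⇔ ⇔-sym (rightB⇔ x y)) ×-⇔ (⇔-sym (downB⇔ x y) ⊎-⇔ ⇔-sym (upB⇔ x y)))
      ⇔-∘ TwoWhite⇔ D (ξ x y)
            (λ (l , r) → 0≢last (trans (sym (from (leftB⇔ x y) l)) (from (rightB⇔ x y) r)))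
            (λ (d , u) → 0≢last (trans (sym (from (downB⇔ x y) d)) (from (upB⇔ x y) u)))
    where
    0≢last : ∀ {k} → 0F ≢ fromℕ (suc k)
    0≢last ()

  twoWhite⇔special : ∀ d → (Σ (Tl D) λ t → Carries D chain d t × TwoWhite D t) ⇔ Special D chain d
  twoWhite⇔special d with x , y , refl ← cell-surjective d =
    mk⇔ extreme→special special→extreme
      ⇔-∘ (twoWhite⇔extreme x y ⇔-∘ mk⇔ carried (λ w → ξ x y , carries-cell x y , w))
    where
    carried : (Σ (Tl D) λ t → Carries D chain (cell x y) t × TwoWhite D t) → TwoWhite D (ξ x y)
    carried (t , (_ , refl) , w) = subst (TwoWhite D) (tileAt-cell x y) w

  HoriStep : Fin (m * n) → Tl D → Set
  HoriStep d t = d ≢ cell lastX lastY →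
    Σ (Tl D) λ t' → (t' ∈ T D)
      × (∀ e → toℕ e ≡ suc (toℕ d) → t' ≡ tileAt e)
      × HCompat D t t'
      × (DownB D t → (¬ RightB D t) ⇔ DownB D t')
      × (UpB D t → UpB D t')

  hori : ∀ x y → HoriStep (cell x y) (ξ x y)
  hori x y notRU with x ≟ᶠ lastX
  ... | no x≢last =
    ξ x' y , ξ∈T x' y ,
    (λ e d→e → tile-after x' y 1 (toℕ-cell-right x x' y (toℕ-fromℕ< x+1<n)) e (there d→e here)) ,
    hcompat x y x+1<n ,
    (λ down → mk⇔ (λ _ → to (downB⇔ x' y) (from (downB⇔ x y) down))
                  (λ _ → x≢last ∘ from (rightB⇔ x y))) ,
    to (upB⇔ x' y) ∘ from (upB⇔ x y)
    where
    x+1<n : suc (toℕ x) < n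
    x+1<n = suc-toℕ< x x≢last
    x' : Fin n
    x' = fromℕ< x+1<n
  ... | yes refl with y ≟ᶠ lastY
  ...   | yes refl = ⊥-elim (notRU refl)
  ...   | no y≢last =
    ξ 0F y' , ξ∈T 0F y' ,
    (λ e d→e → tile-after 0F y' 1 (toℕ-cell-wrap y y' (toℕ-fromℕ< y+1<m)) e (there d→e here)) ,
    trans (to (rightB⇔ lastX y) refl) (sym (to (leftB⇔ 0F y') refl)) ,
    (λ _ → mk⇔ (λ notRight → ⊥-elim (notRight (to (rightB⇔ lastX y) refl)))
               (λ down' → ⊥-elim (y'≢0F (from (downB⇔ 0F y') down')))) ,
    ⊥-elim ∘ y≢last ∘ from (upB⇔ lastX y)
    where
    y+1<m : suc (toℕ y) < m
    y+1<m = suc-toℕ< y y≢last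
    y' : Fin m
    y' = fromℕ< y+1<m
    y'≢0F : y' ≢ 0F
    y'≢0F ()

  VertStep : Fin (m * n) → Tl D → Set
  VertStep d t = ¬ UpB D t →
    Σ (Tl D) λ t' → (t' ∈ T D)
      × (∀ e → RPath D chain d e n → t' ≡ tileAt e)
      × VCompat D t t'
      × (LeftB D t ⇔ LeftB D t')
      × (RightB D t ⇔ RightB D t')

  verti : ∀ x y → VertStep (cell x y) (ξ x y)
  verti x y notUp =
    ξ x y' , ξ∈T x y' ,
    tile-after x y' n (toℕ-cell-up x y y' (toℕ-fromℕ< y+1<m)) ,
    vcompat x y y+1<m ,
    leftB⇔ x y' ⇔-∘ ⇔-sym (leftB⇔ x y) ,
    rightB⇔ x y' ⇔-∘ ⇔-sym (rightB⇔ x y)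
    where
    y+1<m : suc (toℕ y) < m
    y+1<m = suc-toℕ< y (notUp ∘ to (upB⇔ x y))
    y' : Fin m
    y' = fromℕ< y+1<m

  snake : Snake D chain
  snake = record
    { sPath    = _ , _ , _ , ld→rd , proj₂ (rpath-< rd<lu) , row-path lastX lastY
    ; sNoLoop  = no-loop _ , no-loop _ , no-loop _ , no-loop _
    ; sUniqTil = λ d _ → tileAt d , (tileAt∈T d , refl) , λ _ → proj₂
    ; sSpecTil = λ d _ → twoWhite⇔special d
    ; sSpecLD  = ξ 0F 0F , carries-cell 0F 0F , to (leftB⇔ 0F 0F) refl , to (downB⇔ 0F 0F) refl
    ; sSpecRD  = ξ lastX 0F , carries-cell lastX 0F , to (rightB⇔ lastX 0F) refl , to (downB⇔ lastX 0F) refl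
    ; sSpecLU  = ξ 0F lastY , carries-cell 0F lastY , to (leftB⇔ 0F lastY) refl , to (upB⇔ 0F lastY) refl
    ; sSpecRU  = ξ lastX lastY , carries-cell lastX lastY , to (rightB⇔ lastX lastY) refl , to (upB⇔ lastX lastY) refl
    ; sHori    = λ d _ notRU t c → cell-carrier-elim {HoriStep} hori d t c notRU
    ; N        = n
    ; N-pos    = z<s
    ; sLenAll  = λ _ p → RPath-length p ld→rd
    ; sLenUniq = λ { (suc _) _ allLen → cong suc (sym (allLen a ld→rd)) }
    ; sLenOnly = λ _ p → RPath-functional p ld→rd
    ; sVerti   = λ d _ t c notUp → cell-carrier-elim {VertStep} verti d t c notUp
    }

lemma4p3 : (D : DTS) → AtMostTwoWhite D → Solvable D → HasSnake D
lemma4p3 D _ (zero , _ , () , _)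
lemma4p3 D _ (suc _ , zero , _ , () , _)
lemma4p3 D atMostTwo (suc zero , suc _ , _ , _ , cov) =
  ⊥-elim (thinCover-impossible D atMostTwo cov (inj₁ refl))
lemma4p3 D atMostTwo (suc (suc _) , suc zero , _ , _ , cov) =
  ⊥-elim (thinCover-impossible D atMostTwo cov (inj₂ refl))
lemma4p3 D _ (suc (suc _) , suc (suc _) , _ , _ , cov) = Grid.chain D cov , Grid.snake D cov
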